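{- Let $n,m,r,t\ge 0$ and let $\mathbb{F}$ be a field. Let $P'$ be a square matrix over $\mathbb{F}$ written in $6\times 6$ block form $(P_{ij})$ with diagonal block sizes $n,m,n,r,r,t$. Let $M$ be the block-diagonal-structured matrix with the same block sizes whose only nonzero blocks are $M_{13}=\mathrm{I}_n$, $M_{31}=-\mathrm{I}_n$, $M_{45}=\mathrm{I}_r$, $M_{54}=-\mathrm{I}_r$. If $\sigma P' M (P')^t=M$ for some nonzero scalar $\sigma\in\mathbb{F}$, then $P_{21},P_{23},P_{24},P_{25},P_{61},P_{63},P_{64},P_{65}$ are all zero. -}

module Defs where

open import Level using (Level; _⊔_) renaming (suc to lsuc)
open import Data.Nat using (ℕ; _+_)
open import Data.Fin using (Fin; _↑ˡ_; _↑ʳ_; splitAt)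
open import Data.Sum using (_⊎_; inj₁; inj₂)
open import Data.Product using (∃)
open import Relation.Nullary using (¬_; yes; no)
open import Data.Fin using (_≟_)
open import Algebra.Bundles using (CommutativeRing)
import Algebra.Properties.Monoid.Sum as MonoidSum

-- A field: a commutative ring with 0 ≠ 1 in which every nonzero element
-- has a multiplicative inverse (the standard library has no Field bundle).
record Field (c ℓ : Level) : Set (lsuc (c ⊔ ℓ)) where
  field
    commutativeRing : CommutativeRing c ℓ
  open CommutativeRing commutativeRing public
  field
    0≉1     : ¬ (0# ≈ 1#)
    inverse : ∀ x → ¬ (x ≈ 0#) → ∃ λ y → x * y ≈ 1#

blockSize : ℕ → ℕ → ℕ → ℕ → ℕ
blockSize n m r t = n + (m + (n + (r + (r + t))))

module _ {n m r t : ℕ} where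
  emb₁ : Fin n → Fin (blockSize n m r t)
  emb₁ a = a ↑ˡ (m + (n + (r + (r + t))))

  emb₂ : Fin m → Fin (blockSize n m r t)
  emb₂ a = n ↑ʳ (a ↑ˡ (n + (r + (r + t))))

  emb₃ : Fin n → Fin (blockSize n m r t)
  emb₃ a = n ↑ʳ (m ↑ʳ (a ↑ˡ (r + (r + t))))

  emb₄ : Fin r → Fin (blockSize n m r t)
  emb₄ a = n ↑ʳ (m ↑ʳ (n ↑ʳ (a ↑ˡ (r + t))))

  emb₅ : Fin r → Fin (blockSize n m r t)
  emb₅ a = n ↑ʳ (m ↑ʳ (n ↑ʳ (r ↑ʳ (a ↑ˡ t))))

  emb₆ : Fin t → Fin (blockSize n m r t)
  emb₆ a = n ↑ʳ (m ↑ʳ (n ↑ʳ (r ↑ʳ (r ↑ʳ a))))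

  Block : Set
  Block = Fin n ⊎ (Fin m ⊎ (Fin n ⊎ (Fin r ⊎ (Fin r ⊎ Fin t))))

  whichBlock : Fin (blockSize n m r t) → Block
  whichBlock i with splitAt n i
  ... | inj₁ a = inj₁ a
  ... | inj₂ i₂ with splitAt m i₂
  ...   | inj₁ a = inj₂ (inj₁ a)
  ...   | inj₂ i₃ with splitAt n i₃
  ...     | inj₁ a = inj₂ (inj₂ (inj₁ a))
  ...     | inj₂ i₄ with splitAt r i₄
  ...       | inj₁ a = inj₂ (inj₂ (inj₂ (inj₁ a)))
  ...       | inj₂ i₅ with splitAt r i₅
  ...         | inj₁ a = inj₂ (inj₂ (inj₂ (inj₂ (inj₁ a))))
  ...         | inj₂ a = inj₂ (inj₂ (inj₂ (inj₂ (inj₂ a))))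

module _ {c ℓ : Level} (F : Field c ℓ) where
  open Field F
  open MonoidSum +-monoid using (sum)

  Matrix : ℕ → ℕ → Set c
  Matrix a b = Fin a → Fin b → Carrier

  _⊗_ : ∀ {a b d} → Matrix a b → Matrix b d → Matrix a d
  (A ⊗ B) i k = sum (λ j → A i j * B j k)

  transpose : ∀ {a b} → Matrix a b → Matrix b a
  transpose A i j = A j i

  scale : ∀ {a b} → Carrier → Matrix a b → Matrix a b
  scale σ A i j = σ * A i j

  _≈ᴹ_ : ∀ {a b} → Matrix a b → Matrix a b → Set ℓ
  A ≈ᴹ B = ∀ i j → A i j ≈ B i j

  δ : ∀ {k} → Fin k → Fin k → Carrier
  δ a b with a ≟ b
  ... | yes _ = 1#
  ... | no _ = 0#

  -- The matrix M: only nonzero blocks are M₁₃ = I, M₃₁ = -I, M₄₅ = I, M₅₄ = -I.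
  Mform : ∀ n m r t → Matrix (blockSize n m r t) (blockSize n m r t)
  Mform n m r t i j = go (whichBlock i) (whichBlock j)
    where
    go : Block {n} {m} {r} {t} → Block {n} {m} {r} {t} → Carrier
    go (inj₁ a) (inj₂ (inj₂ (inj₁ b))) = δ a b
    go (inj₂ (inj₂ (inj₁ a))) (inj₁ b) = - δ a b
    go (inj₂ (inj₂ (inj₂ (inj₁ a)))) (inj₂ (inj₂ (inj₂ (inj₂ (inj₁ b))))) = δ a b
    go (inj₂ (inj₂ (inj₂ (inj₂ (inj₁ a))))) (inj₂ (inj₂ (inj₂ (inj₁ b)))) = - δ a b
    go _ _ = 0#

module Submission where

-- On the blocks 1, 4, 3, 5 the form M is the standard symplectic form J, and all rows and
-- columns of M in the blocks 2 and 6 vanish.  Writing Q for the square block of P on the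
-- indices of J, the hypothesis gives σ Q J Qᵀ = J, so Q has the right inverse σ J Qᵀ Jᵀ.
-- For a row p of P in the blocks 2 or 6 it gives Q (σ p J)ᵀ = 0, where p is restricted to the
-- indices of J.  A square matrix with a right inverse has trivial kernel (det Q · det R = 1
-- and Cramer's rule; multiplicativity of det over a commutative ring comes from the
-- uniqueness of alternating multilinear forms), so σ p J = 0 and hence p = 0 there.

open import Defs
open import Level using (Level)
open import Data.Nat using (ℕ)
open import Data.Product using (_×_)
open import Relation.Nullary using (¬_)

open import Algebra.Bundles using (CommutativeRing)
open import Data.Empty using (⊥-elim)
open import Data.Fin as Fin
  using (Fin; zero; suc; punchIn; punchOut; _≟_; inject₁; toℕ; _↑ˡ_; _↑ʳ_; splitAt; join)
open import Data.Fin.Properties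
  using (punchInᵢ≢i; punchIn-injective; punchIn-punchOut; suc-injective; toℕ-injective; toℕ-inject₁;
         toℕ<n; toℕ-fromℕ<; ↑ˡ-injective; ↑ʳ-injective; splitAt-↑ˡ; splitAt-↑ʳ; splitAt-join; join-splitAt)
open import Data.Nat as ℕ using (zero; suc; s≤s; z≤n)
open import Data.Nat.Properties
  using (<-cmp; ≤∧≢⇒<; <⇒≢; <⇒≱; ≤-<-trans) renaming (suc-injective to ℕ-suc-injective)
open import Data.Product using (Σ; _,_; proj₁; proj₂)
open import Data.Sum as Sum using (_⊎_; inj₁; inj₂; [_,_]′)
open import Data.Sum.Properties using (swap-involutive)
open import Data.Vec.Functional using (updateAt; insertAt)
open import Data.Vec.Functional.Properties using (updateAt-updates; updateAt-minimal)
open import Function using (_∘_; const)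
open import Function.Definitions using (Injective)
open import Level using (_⊔_)
open import Relation.Binary.Definitions using (tri<; tri≈; tri>)
open import Relation.Binary.PropositionalEquality as ≡ using (_≡_; _≢_)
open import Relation.Nullary using (yes; no)

↑ˡ≢↑ʳ : ∀ {a b} (x : Fin a) (y : Fin b) → x ↑ˡ b ≢ a ↑ʳ y
↑ˡ≢↑ʳ {a} {b} x y eq with ≡.trans (≡.sym (splitAt-↑ˡ a x b)) (≡.trans (≡.cong (splitAt a) eq) (splitAt-↑ʳ a b y))
... | ()

module Determinant {c ℓ} (R : CommutativeRing c ℓ) where
  open CommutativeRing R hiding (zero)
  open import Algebra.Properties.Ring ring
    using (-‿involutive; -0#≈0#; +-inverseʳ-unique; -‿distribˡ-*)
  open import Algebra.Properties.Semiring.Sum semiring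
  open import Algebra.Properties.CommutativeSemigroup *-commutativeSemigroup using (x∙yz≈y∙xz)
  open import Algebra.Solver.Ring.NaturalCoefficients.Default commutativeSemiring
  open import Relation.Binary.Reasoning.Setoid setoid

  Mat : ℕ → Set c
  Mat n = Fin n → Fin n → Carrier

  infix 4 _≋_
  _≋_ : ∀ {n} → Mat n → Mat n → Set ℓ
  X ≋ Y = ∀ i j → X i j ≈ Y i j

  infixl 7 _⊛_
  _⊛_ : ∀ {n} → Mat n → Mat n → Mat n
  (A ⊛ B) i k = sum (λ l → A i l * B l k)

  1ᴹ : ∀ {n} → Mat n
  1ᴹ i j with i ≟ j
  ... | yes _ = 1#
  ... | no _ = 0#

  1ᴹ-diag : ∀ {n} (i : Fin n) → 1ᴹ i i ≈ 1#
  1ᴹ-diag i with i ≟ i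
  ... | yes _ = refl
  ... | no i≢i = ⊥-elim (i≢i ≡.refl)

  1ᴹ-offdiag : ∀ {n} {i j : Fin n} → i ≢ j → 1ᴹ i j ≈ 0#
  1ᴹ-offdiag {i = i} {j} i≢j with i ≟ j
  ... | yes i≡j = ⊥-elim (i≢j i≡j)
  ... | no _ = refl

  1ᴹ-sym : ∀ {n} (i j : Fin n) → 1ᴹ i j ≈ 1ᴹ j i
  1ᴹ-sym i j with i ≟ j
  ... | yes ≡.refl = sym (1ᴹ-diag i)
  ... | no i≢j = sym (1ᴹ-offdiag (i≢j ∘ ≡.sym))

  1ᴹ-reindex : ∀ {m n} (f : Fin m → Fin n) → Injective _≡_ _≡_ f → ∀ i j → 1ᴹ (f i) (f j) ≈ 1ᴹ i j
  1ᴹ-reindex f f-inj i j with i ≟ j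
  ... | yes ≡.refl = 1ᴹ-diag (f i)
  ... | no i≢j = 1ᴹ-offdiag (i≢j ∘ f-inj)

  δ⊎ : ∀ {a b} → Fin a ⊎ Fin b → Fin a ⊎ Fin b → Carrier
  δ⊎ (inj₁ x) (inj₁ y) = 1ᴹ x y
  δ⊎ (inj₂ x) (inj₂ y) = 1ᴹ x y
  δ⊎ _ _ = 0#

  1ᴹ-join : ∀ a b (u v : Fin a ⊎ Fin b) → 1ᴹ (join a b u) (join a b v) ≈ δ⊎ u v
  1ᴹ-join a b (inj₁ x) (inj₁ y) = 1ᴹ-reindex (_↑ˡ b) (↑ˡ-injective b _ _) x y
  1ᴹ-join a b (inj₂ x) (inj₂ y) = 1ᴹ-reindex (a ↑ʳ_) (↑ʳ-injective a _ _) x y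
  1ᴹ-join a b (inj₁ x) (inj₂ y) = 1ᴹ-offdiag (↑ˡ≢↑ʳ x y)
  1ᴹ-join a b (inj₂ x) (inj₁ y) = 1ᴹ-offdiag (↑ˡ≢↑ʳ y x ∘ ≡.sym)

  1ᴹ-splitAt : ∀ a {b} (x y : Fin (a ℕ.+ b)) → 1ᴹ x y ≈ δ⊎ (splitAt a x) (splitAt a y)
  1ᴹ-splitAt a {b} x y = trans (reflexive (≡.sym (≡.cong₂ 1ᴹ (join-splitAt a b x) (join-splitAt a b y))))
                               (1ᴹ-join a b (splitAt a x) (splitAt a y))

  sum-cong : ∀ {n} {f g : Fin n → Carrier} → (∀ i → f i ≈ g i) → sum f ≈ sum g
  sum-cong = sum-cong-≋

  sum-≈0 : ∀ {n} (f : Fin n → Carrier) → (∀ i → f i ≈ 0#) → sum f ≈ 0#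
  sum-≈0 {n} f f≈0 = trans (sum-cong-≋ f≈0) (sum-replicate-zero n)

  sum-concentrated : ∀ {n} (f : Fin n → Carrier) j → (∀ i → i ≢ j → f i ≈ 0#) → sum f ≈ f j
  sum-concentrated {suc n} f j f≈0 = begin
    sum f                              ≈⟨ sum-remove {i = j} f ⟩
    f j + sum (λ k → f (punchIn j k))  ≈⟨ +-congˡ (sum-≈0 _ (λ k → f≈0 (punchIn j k) (punchInᵢ≢i j k))) ⟩
    f j + 0#                           ≈⟨ +-identityʳ _ ⟩
    f j                                ∎

  sum-concentrated₂ : ∀ {n} (f : Fin n → Carrier) a b → a ≢ b →
                      (∀ i → i ≢ a → i ≢ b → f i ≈ 0#) → sum f ≈ f a + f b
  sum-concentrated₂ {suc n} f a b a≢b f≈0 = begin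
    sum f                              ≈⟨ sum-remove {i = a} f ⟩
    f a + sum (λ k → f (punchIn a k))  ≈⟨ +-congˡ (sum-concentrated _ b′ off-b′) ⟩
    f a + f (punchIn a b′)             ≡⟨ ≡.cong (λ k → f a + f k) (punchIn-punchOut a≢b) ⟩
    f a + f b                          ∎
    where
    b′ : Fin n
    b′ = punchOut a≢b
    off-b′ : ∀ k → k ≢ b′ → f (punchIn a k) ≈ 0#
    off-b′ k k≢b′ = f≈0 (punchIn a k) (punchInᵢ≢i a k)
      (λ eq → k≢b′ (punchIn-injective a k b′ (≡.trans eq (≡.sym (punchIn-punchOut a≢b)))))

  sum-factor : ∀ {n} x (f g : Fin n → Carrier) → sum (λ i → f i * (x * g i)) ≈ x * sum (λ i → f i * g i)
  sum-factor x f g = trans (sum-cong {f = λ i → f i * (x * g i)} (λ i → x∙yz≈y∙xz (f i) x (g i)))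
                           (sym (*-distribˡ-sum x (λ i → f i * g i)))

  sum-*-1ᴹ : ∀ {n} (g : Fin n → Carrier) j → sum (λ i → g i * 1ᴹ i j) ≈ g j
  sum-*-1ᴹ g j = trans (sum-concentrated _ j (λ i i≢j → trans (*-congˡ (1ᴹ-offdiag i≢j)) (zeroʳ _)))
                       (trans (*-congˡ (1ᴹ-diag j)) (*-identityʳ _))

  -- Laplace expansion

  sign : ∀ {n} → Fin n → Carrier
  sign zero = 1#
  sign (suc j) = - sign j

  minor : ∀ {n} → Mat (suc n) → Fin (suc n) → Mat n
  minor X j a b = X (suc a) (punchIn j b)

  mutual
    det : ∀ {n} → Mat n → Carrier
    det {zero} X = 1#
    det {suc n} X = sum (row₀-term X)

    row₀-term : ∀ {n} → Mat (suc n) → Fin (suc n) → Carrier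
    row₀-term X j = sign j * (X zero j * det (minor X j))

  det-cong : ∀ {n} {X Y : Mat n} → X ≋ Y → det X ≈ det Y
  det-cong {zero} X≋Y = refl
  det-cong {suc n} {X} {Y} X≋Y = sum-cong {f = row₀-term X} {g = row₀-term Y} λ j →
    *-congˡ (*-cong (X≋Y zero j) (det-cong (λ a b → X≋Y (suc a) (punchIn j b))))

  AgreeOff : ∀ {n} → Fin n → Mat n → Mat n → Set ℓ
  AgreeOff c X Y = ∀ i k → k ≢ c → X i k ≈ Y i k

  minor-agree : ∀ {n} {X Y : Mat (suc n)} {c} → AgreeOff c X Y → minor X c ≋ minor Y c
  minor-agree {c = c} X~Y a b = X~Y (suc a) (punchIn c b) (punchInᵢ≢i c b)

  minor-agreeOff : ∀ {n} {X Y : Mat (suc n)} {c j} (j≢c : j ≢ c) →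
                   AgreeOff c X Y → AgreeOff (punchOut j≢c) (minor X j) (minor Y j)
  minor-agreeOff {j = j} j≢c X~Y a b b≢c′ = X~Y (suc a) (punchIn j b) λ eq →
    b≢c′ (punchIn-injective j b _ (≡.trans eq (≡.sym (punchIn-punchOut j≢c))))

  at-punchOut : ∀ {n} (P : Fin (suc n) → Set ℓ) {c j} (j≢c : j ≢ c) → P c → P (punchIn j (punchOut j≢c))
  at-punchOut P j≢c = ≡.subst P (≡.sym (punchIn-punchOut j≢c))

  ColumnAdditive : ∀ {n} → (Mat n → Carrier) → Set (c ⊔ ℓ)
  ColumnAdditive F = ∀ X Y Z k → AgreeOff k X Z → AgreeOff k Y Z →
                     (∀ i → Z i k ≈ X i k + Y i k) → F Z ≈ F X + F Y

  ColumnHomogeneous : ∀ {n} → (Mat n → Carrier) → Set (c ⊔ ℓ)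
  ColumnHomogeneous F = ∀ X Z k s → AgreeOff k X Z → (∀ i → Z i k ≈ s * X i k) → F Z ≈ s * F X

  AlternatingAt : ∀ {n} → Fin n → Fin n → (Mat n → Carrier) → Set (c ⊔ ℓ)
  AlternatingAt a b F = ∀ X → (∀ i → X i a ≈ X i b) → F X ≈ 0#

  det-additive : ∀ {n} → ColumnAdditive (det {n})
  det-additive {suc n} X Y Z c X~Z Y~Z Zc = trans (sum-cong {f = row₀-term Z} term) (∑-distrib-+ (row₀-term X) (row₀-term Y))
    where
    term : ∀ j → row₀-term Z j ≈ row₀-term X j + row₀-term Y j
    term j with j ≟ c
    ... | yes ≡.refl = begin
      sign j * (Z zero j * det (minor Z j))
        ≈⟨ *-congˡ (*-cong (Zc zero) (det-cong (λ a b → sym (minor-agree X~Z a b)))) ⟩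
      sign j * ((X zero j + Y zero j) * det (minor X j))
        ≈⟨ trans (*-congˡ (distribʳ _ _ _)) (distribˡ _ _ _) ⟩
      sign j * (X zero j * det (minor X j)) + sign j * (Y zero j * det (minor X j))
        ≈⟨ +-congˡ (*-congˡ (*-congˡ (det-cong λ a b → trans (minor-agree X~Z a b) (sym (minor-agree Y~Z a b))))) ⟩
      sign j * (X zero j * det (minor X j)) + sign j * (Y zero j * det (minor Y j)) ∎
    ... | no j≢c = begin
      sign j * (Z zero j * det (minor Z j))
        ≈⟨ *-congˡ (*-congˡ (det-additive (minor X j) (minor Y j) (minor Z j) (punchOut j≢c)
             (minor-agreeOff j≢c X~Z) (minor-agreeOff j≢c Y~Z)
             (λ a → at-punchOut (λ k → Z (suc a) k ≈ X (suc a) k + Y (suc a) k) j≢c (Zc (suc a))))) ⟩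
      sign j * (Z zero j * (det (minor X j) + det (minor Y j)))
        ≈⟨ trans (*-congˡ (distribˡ _ _ _)) (distribˡ _ _ _) ⟩
      sign j * (Z zero j * det (minor X j)) + sign j * (Z zero j * det (minor Y j))
        ≈⟨ +-cong (*-congˡ (*-congʳ (sym (X~Z zero j j≢c)))) (*-congˡ (*-congʳ (sym (Y~Z zero j j≢c)))) ⟩
      sign j * (X zero j * det (minor X j)) + sign j * (Y zero j * det (minor Y j)) ∎

  det-homogeneous : ∀ {n} → ColumnHomogeneous (det {n})
  det-homogeneous {suc n} X Z c s X~Z Zc =
    trans (sum-cong {f = row₀-term Z} term) (sym (*-distribˡ-sum s (row₀-term X)))
    where
    term : ∀ j → row₀-term Z j ≈ s * row₀-term X j
    term j with j ≟ c
    ... | yes ≡.refl = begin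
      sign j * (Z zero j * det (minor Z j))
        ≈⟨ *-congˡ (*-cong (Zc zero) (det-cong (λ a b → sym (minor-agree X~Z a b)))) ⟩
      sign j * ((s * X zero j) * det (minor X j))
        ≈⟨ solve 4 (λ e s x d → e :* ((s :* x) :* d) := s :* (e :* (x :* d))) refl _ _ _ _ ⟩
      s * (sign j * (X zero j * det (minor X j))) ∎
    ... | no j≢c = begin
      sign j * (Z zero j * det (minor Z j))
        ≈⟨ *-congˡ (*-cong (sym (X~Z zero j j≢c))
             (det-homogeneous (minor X j) (minor Z j) (punchOut j≢c) s (minor-agreeOff j≢c X~Z)
               (λ a → at-punchOut (λ k → Z (suc a) k ≈ s * X (suc a) k) j≢c (Zc (suc a))))) ⟩
      sign j * (X zero j * (s * det (minor X j)))
        ≈⟨ solve 4 (λ e x s d → e :* (x :* (s :* d)) := s :* (e :* (x :* d))) refl _ _ _ _ ⟩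
      s * (sign j * (X zero j * det (minor X j))) ∎

  minorᵗ : ∀ {n} → Mat (suc n) → Fin (suc n) → Mat n
  minorᵗ X i a b = X (punchIn i a) (suc b)

  col₀-term : ∀ {n} → Mat (suc n) → Fin (suc n) → Carrier
  col₀-term X i = sign i * (X i zero * det (minorᵗ X i))

  -- Expanding along row 0 and then column 0, or the other way round, gives the same double
  -- sum: the minors of minors coincide definitionally.
  det-expand-col₀ : ∀ {n} (X : Mat (suc n)) → det X ≈ sum (col₀-term X)
  det-expand-col₀ {zero} X = refl
  det-expand-col₀ {suc n} X = +-congˡ (begin
    sum (λ j → row₀-term X (suc j))
      ≈⟨ sum-cong {f = λ j → row₀-term X (suc j)} {g = λ j → sum (T j)} (λ j → begin
           row₀-term X (suc j)
             ≈⟨ *-congˡ (*-congˡ (det-expand-col₀ (minor X (suc j)))) ⟩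
           - sign j * (X zero (suc j) * sum (col₀-term (minor X (suc j))))
             ≈⟨ scale-sum _ _ (col₀-term (minor X (suc j))) ⟩
           sum (T j) ∎) ⟩
    sum (λ j → sum (T j))
      ≈⟨ ∑-comm T ⟩
    sum (λ i → sum (λ j → T j i))
      ≈⟨ sum-cong {f = λ i → sum (λ j → T j i)} {g = λ i → sum (T′ i)}
           (λ i → sum-cong {f = λ j → T j i} {g = T′ i} (λ j → swap-factors _ _ _ _ _)) ⟩
    sum (λ i → sum (T′ i))
      ≈⟨ sum-cong {f = λ i → sum (T′ i)} {g = λ i → col₀-term X (suc i)}
           (λ i → sym (scale-sum _ _ (row₀-term (minorᵗ X (suc i))))) ⟩
    sum (λ i → col₀-term X (suc i)) ∎)
    where
    T : Fin (suc n) → Fin (suc n) → Carrier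
    T j i = - sign j * (X zero (suc j) * col₀-term (minor X (suc j)) i)
    T′ : Fin (suc n) → Fin (suc n) → Carrier
    T′ i j = - sign i * (X (suc i) zero * row₀-term (minorᵗ X (suc i)) j)
    scale-sum : ∀ {m} x y (h : Fin m → Carrier) → x * (y * sum h) ≈ sum (λ i → x * (y * h i))
    scale-sum x y h = trans (*-congˡ (*-distribˡ-sum y h)) (*-distribˡ-sum x (λ i → y * h i))
    swap-factors : ∀ s t a b d → - s * (a * (t * (b * d))) ≈ - t * (b * (s * (a * d)))
    swap-factors s t a b d = begin
      - s * (a * (t * (b * d)))   ≈⟨ sym (-‿distribˡ-* _ _) ⟩
      - (s * (a * (t * (b * d)))) ≈⟨ -‿cong (solve 5 (λ s t a b d →
                                      s :* (a :* (t :* (b :* d))) := t :* (b :* (s :* (a :* d)))) refl s t a b d) ⟩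
      - (t * (b * (s * (a * d)))) ≈⟨ -‿distribˡ-* _ _ ⟩
      - t * (b * (s * (a * d)))   ∎

  -- Alternation

  punchIn-around-adjacent : ∀ {m} (j : Fin (suc (suc m))) (d : Fin (suc m)) → j ≢ inject₁ d → j ≢ suc d →
                            Σ (Fin m) λ e → punchIn j (inject₁ e) ≡ inject₁ d × punchIn j (suc e) ≡ suc d
  punchIn-around-adjacent zero zero j≢d _ = ⊥-elim (j≢d ≡.refl)
  punchIn-around-adjacent zero (suc e) _ _ = e , ≡.refl , ≡.refl
  punchIn-around-adjacent (suc zero) zero _ j≢d+1 = ⊥-elim (j≢d+1 ≡.refl)
  punchIn-around-adjacent {suc m} (suc (suc j)) zero _ _ = zero , ≡.refl , ≡.refl
  punchIn-around-adjacent {suc m} (suc j) (suc d) j≢d j≢d+1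
    with punchIn-around-adjacent j d (j≢d ∘ ≡.cong suc) (j≢d+1 ∘ ≡.cong suc)
  ... | e , p , q = suc e , ≡.cong suc p , ≡.cong suc q

  punchIn-inject₁-suc : ∀ {n} (d b : Fin n) →
                        punchIn (inject₁ d) b ≡ punchIn (suc d) b ⊎
                        (punchIn (inject₁ d) b ≡ suc d × punchIn (suc d) b ≡ inject₁ d)
  punchIn-inject₁-suc zero zero = inj₂ (≡.refl , ≡.refl)
  punchIn-inject₁-suc zero (suc b) = inj₁ ≡.refl
  punchIn-inject₁-suc (suc d) zero = inj₁ ≡.refl
  punchIn-inject₁-suc (suc d) (suc b) with punchIn-inject₁-suc d b
  ... | inj₁ p = inj₁ (≡.cong suc p)
  ... | inj₂ (p , q) = inj₂ (≡.cong suc p , ≡.cong suc q)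

  inject₁≢suc : ∀ {n} (d : Fin n) → inject₁ d ≢ suc d
  inject₁≢suc zero ()
  inject₁≢suc (suc d) eq = inject₁≢suc d (suc-injective eq)

  sign-inject₁ : ∀ {n} (d : Fin n) → sign (inject₁ d) ≡ sign d
  sign-inject₁ zero = ≡.refl
  sign-inject₁ (suc d) = ≡.cong -_ (sign-inject₁ d)

  -- Only the two terms for the equal columns survive, and they cancel.
  det-alternating-adjacent : ∀ {n} (d : Fin n) → AlternatingAt (inject₁ d) (suc d) (det {suc n})
  det-alternating-adjacent {suc m} d X X-eq =
    trans (sum-concentrated₂ (row₀-term X) (inject₁ d) (suc d) (inject₁≢suc d) other-term) cancel
    where
    other-term : ∀ j → j ≢ inject₁ d → j ≢ suc d → row₀-term X j ≈ 0#
    other-term j j≢d j≢d+1 with punchIn-around-adjacent j d j≢d j≢d+1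
    ... | e , p , q = trans (*-congˡ (*-congˡ (det-alternating-adjacent e (minor X j) minor-eq)))
                            (trans (*-congˡ (zeroʳ _)) (zeroʳ _))
      where
      minor-eq : ∀ i → minor X j i (inject₁ e) ≈ minor X j i (suc e)
      minor-eq i = ≡.subst₂ (λ u v → X (suc i) u ≈ X (suc i) v) (≡.sym p) (≡.sym q) (X-eq (suc i))
    same-minor : minor X (inject₁ d) ≋ minor X (suc d)
    same-minor i b with punchIn-inject₁-suc d b
    ... | inj₁ p = reflexive (≡.cong (X (suc i)) p)
    ... | inj₂ (p , q) = ≡.subst₂ (λ u v → X (suc i) u ≈ X (suc i) v) (≡.sym p) (≡.sym q) (sym (X-eq (suc i)))
    cancel : row₀-term X (inject₁ d) + row₀-term X (suc d) ≈ 0#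
    cancel = begin
      sign (inject₁ d) * (X zero (inject₁ d) * det (minor X (inject₁ d)))
        + - sign d * (X zero (suc d) * det (minor X (suc d)))
        ≈⟨ +-cong (*-cong (reflexive (sign-inject₁ d)) (*-cong (X-eq zero) (det-cong same-minor)))
                  (sym (-‿distribˡ-* _ _)) ⟩
      sign d * (X zero (suc d) * det (minor X (suc d)))
        + - (sign d * (X zero (suc d) * det (minor X (suc d))))
        ≈⟨ -‿inverseʳ _ ⟩
      0# ∎

  column : ∀ {n} → Mat n → Fin n → Fin n → Carrier
  column X k i = X i k

  setColumn : ∀ {n} → Mat n → Fin n → (Fin n → Carrier) → Mat n
  setColumn X k v i = updateAt (X i) k (λ _ → v i)

  module _ {n} (X : Mat n) (k : Fin n) where
    setColumn-here : ∀ v i → setColumn X k v i k ≈ v i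
    setColumn-here v i = reflexive (updateAt-updates k (X i))

    setColumn-other : ∀ v i {j} → j ≢ k → setColumn X k v i j ≈ X i j
    setColumn-other v i {j} j≢k = reflexive (updateAt-minimal j k (X i) j≢k)

    agreeOff-setColumn : ∀ v → AgreeOff k X (setColumn X k v)
    agreeOff-setColumn v i j j≢k = sym (setColumn-other v i j≢k)

    setColumn-agreeOff : ∀ u v → AgreeOff k (setColumn X k u) (setColumn X k v)
    setColumn-agreeOff u v i j j≢k = trans (setColumn-other u i j≢k) (sym (setColumn-other v i j≢k))

    setColumn-id : ∀ v → (∀ i → v i ≈ X i k) → setColumn X k v ≋ X
    setColumn-id v v≈ i j with j ≟ k
    ... | yes ≡.refl = trans (setColumn-here v i) (v≈ i)
    ... | no j≢k = setColumn-other v i j≢k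

  setColumn-preserves-agreeOff : ∀ {n} {X Y : Mat n} {c} a v → AgreeOff c X Y →
                                 AgreeOff c (setColumn X a v) (setColumn Y a v)
  setColumn-preserves-agreeOff {X = X} {Y} a v X~Y i j j≢c with j ≟ a
  ... | yes ≡.refl = trans (setColumn-here X a v i) (sym (setColumn-here Y a v i))
  ... | no j≢a = trans (setColumn-other X a v i j≢a) (trans (X~Y i j j≢c) (sym (setColumn-other Y a v i j≢a)))

  swapColumns : ∀ {n} → Mat n → Fin n → Fin n → Mat n
  swapColumns X a b = setColumn (setColumn X b (column X a)) a (column X b)

  module _ {n} (X : Mat n) (a b : Fin n) where
    swapColumns-first : ∀ i → swapColumns X a b i a ≈ X i b
    swapColumns-first = setColumn-here (setColumn X b (column X a)) a (column X b)

    swapColumns-second : a ≢ b → ∀ i → swapColumns X a b i b ≈ X i a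
    swapColumns-second a≢b i = trans (setColumn-other (setColumn X b (column X a)) a (column X b) i (a≢b ∘ ≡.sym))
                                     (setColumn-here X b (column X a) i)

    swapColumns-other : ∀ i k → k ≢ a → k ≢ b → swapColumns X a b i k ≈ X i k
    swapColumns-other i k k≢a k≢b = trans (setColumn-other (setColumn X b (column X a)) a (column X b) i k≢a)
                                          (setColumn-other X b (column X a) i k≢b)

  -- Expand F on the matrix whose columns a and b both equal (column a + column b).
  swapColumns-negates : ∀ {n} (F : Mat n → Carrier) → (∀ {X Y} → X ≋ Y → F X ≈ F Y) → ColumnAdditive F →
                        ∀ a b → a ≢ b → AlternatingAt a b F → ∀ X → F (swapColumns X a b) ≈ - F X
  swapColumns-negates {n} F F-cong F-additive a b a≢b F-alternating X =
    +-inverseʳ-unique (F X) (F (swapColumns X a b)) (sym (begin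
      0#                                                         ≈⟨ sym (diagonal s) ⟩
      F (S s s)                                                  ≈⟨ additive-first xa xb s ⟩
      F (S xa s) + F (S xb s)                                    ≈⟨ +-cong (additive-second xa xa xb) (additive-second xb xa xb) ⟩
      (F (S xa xa) + F (S xa xb)) + (F (S xb xa) + F (S xb xb))
        ≈⟨ +-cong (+-cong (diagonal xa) (F-cong S-self)) (+-congˡ (diagonal xb)) ⟩
      (0# + F X) + (F (swapColumns X a b) + 0#)                  ≈⟨ +-cong (+-identityˡ _) (+-identityʳ _) ⟩
      F X + F (swapColumns X a b)                                ∎))
    where
    xa xb s : Fin n → Carrier
    xa = column X a
    xb = column X b
    s i = xa i + xb i
    S : (Fin n → Carrier) → (Fin n → Carrier) → Mat n
    S u v = setColumn (setColumn X b v) a u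
    S-first : ∀ u v i → S u v i a ≈ u i
    S-first u v = setColumn-here (setColumn X b v) a u
    S-second : ∀ u v i → S u v i b ≈ v i
    S-second u v i = trans (setColumn-other (setColumn X b v) a u i (a≢b ∘ ≡.sym)) (setColumn-here X b v i)
    S-self : S xa xb ≋ X
    S-self i j = trans (setColumn-id (setColumn X b xb) a xa (λ i → sym (setColumn-other X b xb i a≢b)) i j)
                       (setColumn-id X b xb (λ _ → refl) i j)
    diagonal : ∀ u → F (S u u) ≈ 0#
    diagonal u = F-alternating (S u u) λ i → trans (S-first u u i) (sym (S-second u u i))
    additive-first : ∀ u u′ v → F (S (λ i → u i + u′ i) v) ≈ F (S u v) + F (S u′ v)
    additive-first u u′ v = F-additive (S u v) (S u′ v) (S (λ i → u i + u′ i) v) a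
      (setColumn-agreeOff (setColumn X b v) a u _) (setColumn-agreeOff (setColumn X b v) a u′ _)
      (λ i → trans (S-first (λ i → u i + u′ i) v i) (sym (+-cong (S-first u v i) (S-first u′ v i))))
    additive-second : ∀ u v v′ → F (S u (λ i → v i + v′ i)) ≈ F (S u v) + F (S u v′)
    additive-second u v v′ = F-additive (S u v) (S u v′) (S u (λ i → v i + v′ i)) b
      (setColumn-preserves-agreeOff a u (setColumn-agreeOff X b v _))
      (setColumn-preserves-agreeOff a u (setColumn-agreeOff X b v′ _))
      (λ i → trans (S-second u (λ i → v i + v′ i) i) (sym (+-cong (S-second u v i) (S-second u v′ i))))

  det-swap-adjacent : ∀ {n} (d : Fin n) X → det (swapColumns X (inject₁ d) (suc d)) ≈ - det X
  det-swap-adjacent d = swapColumns-negates det det-cong det-additive (inject₁ d) (suc d) (inject₁≢suc d)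
                          (det-alternating-adjacent d)

  -- Induction on the position k of the right column, which an adjacent swap moves one step left.
  det-alternating-< : ∀ {n} k (a b : Fin n) → toℕ b ≡ k → toℕ a ℕ.< toℕ b → AlternatingAt a b det
  det-alternating-< {n} (suc k) a (suc b) b≡k (s≤s a≤b) X X-eq with toℕ a ℕ.≟ toℕ b
  ... | yes a≡b = det-alternating-adjacent b X λ i →
    ≡.subst (λ u → X i u ≈ X i (suc b)) (toℕ-injective (≡.trans a≡b (≡.sym (toℕ-inject₁ b)))) (X-eq i)
  ... | no a≢b = begin
    det X       ≈⟨ sym (-‿involutive _) ⟩
    - (- det X) ≈⟨ -‿cong (sym (det-swap-adjacent b X)) ⟩
    - det Y     ≈⟨ -‿cong (det-alternating-< k a (inject₁ b) b′≡k a<b Y Y-eq) ⟩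
    - 0#        ≈⟨ -0#≈0# ⟩
    0#          ∎
    where
    Y : Mat n
    Y = swapColumns X (inject₁ b) (suc b)
    b′≡k : toℕ (inject₁ b) ≡ k
    b′≡k = ≡.trans (toℕ-inject₁ b) (ℕ-suc-injective b≡k)
    a<b : toℕ a ℕ.< toℕ (inject₁ b)
    a<b = ≡.subst (toℕ a ℕ.<_) (≡.sym (toℕ-inject₁ b)) (≤∧≢⇒< a≤b a≢b)
    Y-eq : ∀ i → Y i a ≈ Y i (inject₁ b)
    Y-eq i = trans (swapColumns-other X (inject₁ b) (suc b) i a
                     (λ a≡b′ → a≢b (≡.trans (≡.cong toℕ a≡b′) (toℕ-inject₁ b)))
                     (λ a≡b+1 → <⇒≢ (s≤s a≤b) (≡.cong toℕ a≡b+1)))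
             (trans (X-eq i) (sym (swapColumns-first X (inject₁ b) (suc b) i)))

  det-alternating : ∀ {n} (a b : Fin n) → a ≢ b → AlternatingAt a b det
  det-alternating a b a≢b X X-eq with <-cmp (toℕ a) (toℕ b)
  ... | tri< a<b _ _ = det-alternating-< _ a b ≡.refl a<b X X-eq
  ... | tri≈ _ a≡b _ = ⊥-elim (a≢b (toℕ-injective a≡b))
  ... | tri> _ _ b<a = det-alternating-< _ b a ≡.refl b<a X (λ i → sym (X-eq i))

  -- Uniqueness of alternating forms, multiplicativity and Cramer's rule

  record AlternatingForm (n : ℕ) : Set (c ⊔ ℓ) where
    field
      φ             : Mat n → Carrier
      φ-cong        : ∀ {X Y} → X ≋ Y → φ X ≈ φ Y
      φ-additive    : ColumnAdditive φ
      φ-homogeneous : ColumnHomogeneous φ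
      φ-alternating : ∀ a b → a ≢ b → AlternatingAt a b φ

  detForm : ∀ n → AlternatingForm n
  detForm n = record
    { φ = det ; φ-cong = det-cong ; φ-additive = det-additive
    ; φ-homogeneous = det-homogeneous ; φ-alternating = det-alternating }

  shear : ∀ {m} → Mat (suc m) → (Fin m → Carrier) → Mat (suc m)
  shear W κ i zero = W i zero
  shear W κ i (suc b) = W i (suc b) + κ b * W i zero

  module AlternatingFormProperties {n} (E : AlternatingForm n) where
    open AlternatingForm E

    φ-zeroColumn : ∀ X k → (∀ i → X i k ≈ 0#) → φ X ≈ 0#
    φ-zeroColumn X k Xk≈0 =
      trans (φ-homogeneous X X k 0# (λ _ _ _ → refl) (λ i → trans (Xk≈0 i) (sym (zeroˡ _)))) (zeroˡ _)

    φ-linear : ∀ {m} X k (w : Fin m → Carrier) (V : Fin m → Fin n → Carrier) →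
               φ (setColumn X k (λ i → sum (λ t → w t * V t i))) ≈ sum (λ t → w t * φ (setColumn X k (V t)))
    φ-linear {zero} X k w V = φ-zeroColumn _ k (setColumn-here X k _)
    φ-linear {suc m} X k w V = begin
      φ (setColumn X k (λ i → first i + rest i))
        ≈⟨ φ-additive (setColumn X k first) (setColumn X k rest) _ k
             (setColumn-agreeOff X k first _) (setColumn-agreeOff X k rest _)
             (λ i → trans (setColumn-here X k (λ i → first i + rest i) i)
                          (sym (+-cong (setColumn-here X k first i) (setColumn-here X k rest i)))) ⟩
      φ (setColumn X k first) + φ (setColumn X k rest)
        ≈⟨ +-cong (φ-homogeneous (setColumn X k (V zero)) _ k (w zero) (setColumn-agreeOff X k (V zero) first)
                     (λ i → trans (setColumn-here X k first i) (*-congˡ (sym (setColumn-here X k (V zero) i)))))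
                  (φ-linear X k (w ∘ suc) (V ∘ suc)) ⟩
      w zero * φ (setColumn X k (V zero)) + sum (λ t → w (suc t) * φ (setColumn X k (V (suc t)))) ∎
      where
      first rest : Fin n → Carrier
      first i = w zero * V zero i
      rest i = sum (λ t → w (suc t) * V (suc t) i)

    φ-addMultiple : ∀ X a b s → b ≢ a → φ (setColumn X b (λ i → X i b + s * X i a)) ≈ φ X
    φ-addMultiple X a b s b≢a = begin
      φ (setColumn X b (λ i → X i b + s * X i a))
        ≈⟨ φ-additive X (setColumn X b multiple) _ b (agreeOff-setColumn X b _) (setColumn-agreeOff X b multiple _)
             (λ i → trans (setColumn-here X b (λ i → X i b + multiple i) i)
                          (+-congˡ (sym (setColumn-here X b multiple i)))) ⟩
      φ X + φ (setColumn X b multiple)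
        ≈⟨ +-congˡ (φ-homogeneous (setColumn X b (column X a)) _ b s (setColumn-agreeOff X b (column X a) multiple)
             (λ i → trans (setColumn-here X b multiple i) (*-congˡ (sym (setColumn-here X b (column X a) i))))) ⟩
      φ X + s * φ (setColumn X b (column X a))
        ≈⟨ +-congˡ (*-congˡ (φ-alternating b a b≢a _ λ i →
             trans (setColumn-here X b (column X a) i) (sym (setColumn-other X b (column X a) i (b≢a ∘ ≡.sym))))) ⟩
      φ X + s * 0#  ≈⟨ +-congˡ (zeroʳ s) ⟩
      φ X + 0#      ≈⟨ +-identityʳ _ ⟩
      φ X           ∎
      where
      multiple : Fin n → Carrier
      multiple i = s * X i a

  module _ {m} (E : AlternatingForm (suc m)) where
    open AlternatingForm E
    open AlternatingFormProperties E

    φ-shear-below : ∀ k W κ → (∀ b → k ℕ.≤ toℕ b → κ b ≈ 0#) → φ (shear W κ) ≈ φ W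
    φ-shear-below zero W κ κ≈0 = φ-cong λ where
      i zero → refl
      i (suc b) → trans (+-congˡ (trans (*-congʳ (κ≈0 b z≤n)) (zeroˡ _))) (+-identityʳ _)
    φ-shear-below (suc k) W κ κ≈0 with k ℕ.<? m
    ... | no k≮m = φ-shear-below k W κ λ b k≤b → ⊥-elim (k≮m (≤-<-trans k≤b (toℕ<n b)))
    ... | yes k<m = begin
      φ (shear W κ)                    ≈⟨ φ-cong peel ⟩
      φ (setColumn V (suc b₀) added)   ≈⟨ φ-addMultiple V zero (suc b₀) (κ b₀) (λ ()) ⟩
      φ V                              ≈⟨ φ-shear-below k W κ′ κ′≈0 ⟩
      φ W                              ∎
      where
      b₀ : Fin m
      b₀ = Fin.fromℕ< k<m
      κ′ : Fin m → Carrier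
      κ′ = updateAt κ b₀ (λ _ → 0#)
      V : Mat (suc m)
      V = shear W κ′
      κ′-at : κ′ b₀ ≈ 0#
      κ′-at = reflexive (updateAt-updates b₀ κ)
      κ′-off : ∀ {b} → b ≢ b₀ → κ′ b ≈ κ b
      κ′-off {b} b≢b₀ = reflexive (updateAt-minimal b b₀ κ b≢b₀)
      κ′≈0 : ∀ b → k ℕ.≤ toℕ b → κ′ b ≈ 0#
      κ′≈0 b k≤b with b ≟ b₀
      ... | yes ≡.refl = κ′-at
      ... | no b≢b₀ = trans (κ′-off b≢b₀) (κ≈0 b (≤∧≢⇒< k≤b λ k≡b →
                        b≢b₀ (toℕ-injective (≡.trans (≡.sym k≡b) (≡.sym (toℕ-fromℕ< k<m))))))
      added : Fin (suc m) → Carrier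
      added i = V i (suc b₀) + κ b₀ * V i zero
      peel : shear W κ ≋ setColumn V (suc b₀) added
      peel i zero = sym (setColumn-other V (suc b₀) added i {zero} (λ ()))
      peel i (suc b) with b ≟ b₀
      ... | yes ≡.refl = sym (trans (setColumn-here V (suc b₀) added i)
                                    (+-congʳ (trans (+-congˡ (trans (*-congʳ κ′-at) (zeroˡ _))) (+-identityʳ _))))
      ... | no b≢b₀ = sym (trans (setColumn-other V (suc b₀) added i (b≢b₀ ∘ suc-injective))
                                 (+-congˡ (*-congʳ (κ′-off b≢b₀))))

    φ-shear : ∀ W κ → φ (shear W κ) ≈ φ W
    φ-shear W κ = φ-shear-below m W κ λ b m≤b → ⊥-elim (<⇒≱ (toℕ<n b) m≤b)

  insertAt-lift₂ : ∀ {n} (_∼_ : Carrier → Carrier → Set ℓ) {xs ys : Fin n → Carrier} {x y} j →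
                   x ∼ y → (∀ a → xs a ∼ ys a) → ∀ i → insertAt xs j x i ∼ insertAt ys j y i
  insertAt-lift₂ _∼_ zero x∼y xs∼ys zero = x∼y
  insertAt-lift₂ _∼_ zero x∼y xs∼ys (suc i) = xs∼ys i
  insertAt-lift₂ {suc n} _∼_ (suc j) x∼y xs∼ys zero = xs∼ys zero
  insertAt-lift₂ {suc n} _∼_ (suc j) x∼y xs∼ys (suc i) = insertAt-lift₂ _∼_ j x∼y (xs∼ys ∘ suc) i

  insertAt-lift₃ : ∀ {n} (T : Carrier → Carrier → Carrier → Set ℓ) {xs ys zs : Fin n → Carrier} {x y z} j →
                   T x y z → (∀ a → T (xs a) (ys a) (zs a)) →
                   ∀ i → T (insertAt xs j x i) (insertAt ys j y i) (insertAt zs j z i)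
  insertAt-lift₃ T zero t ts zero = t
  insertAt-lift₃ T zero t ts (suc i) = ts i
  insertAt-lift₃ {suc n} T (suc j) t ts zero = ts zero
  insertAt-lift₃ {suc n} T (suc j) t ts (suc i) = insertAt-lift₃ T j t (ts ∘ suc) i

  insertAt-cases : ∀ {n} (P : Fin (suc n) → Carrier → Set ℓ) (xs : Fin n → Carrier) j x →
                   P j x → (∀ a → P (punchIn j a) (xs a)) → ∀ i → P i (insertAt xs j x i)
  insertAt-cases P xs zero x Px Pxs zero = Px
  insertAt-cases P xs zero x Px Pxs (suc i) = Pxs i
  insertAt-cases {suc n} P xs (suc j) x Px Pxs zero = Pxs zero
  insertAt-cases {suc n} P xs (suc j) x Px Pxs (suc i) = insertAt-cases (P ∘ suc) (xs ∘ suc) j x Px (Pxs ∘ suc) i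

  bordered : ∀ {n} → Fin (suc n) → Mat n → Mat (suc n)
  bordered j Z i zero = 1ᴹ i j
  bordered j Z i (suc b) = insertAt (column Z b) j 0# i

  borderedForm : ∀ {n} → AlternatingForm (suc n) → Fin (suc n) → AlternatingForm n
  borderedForm E j = record
    { φ = λ Z → φ (bordered j Z)
    ; φ-cong = λ Z≋Z′ → φ-cong (λ where
        i zero → refl
        i (suc b) → insertAt-lift₂ _≈_ j refl (λ a → Z≋Z′ a b) i)
    ; φ-additive = λ X Y Z k X~Z Y~Z Zk → φ-additive (bordered j X) (bordered j Y) (bordered j Z) (suc k)
        (lift-agreeOff X~Z) (lift-agreeOff Y~Z)
        (insertAt-lift₃ (λ x y z → z ≈ x + y) j (sym (+-identityʳ 0#)) Zk)
    ; φ-homogeneous = λ X Z k s X~Z Zk → φ-homogeneous (bordered j X) (bordered j Z) (suc k) s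
        (lift-agreeOff X~Z) (insertAt-lift₂ (λ x z → z ≈ s * x) j (sym (zeroʳ s)) Zk)
    ; φ-alternating = λ a b a≢b X Xab → φ-alternating (suc a) (suc b) (a≢b ∘ suc-injective) (bordered j X)
        (insertAt-lift₂ _≈_ j refl Xab)
    }
    where
    open AlternatingForm E
    lift-agreeOff : ∀ {X Z k} → AgreeOff k X Z → AgreeOff (suc k) (bordered j X) (bordered j Z)
    lift-agreeOff X~Z i zero _ = refl
    lift-agreeOff X~Z i (suc b) b≢k = insertAt-lift₂ _≈_ j refl (λ a → X~Z a b (b≢k ∘ ≡.cong suc)) i

  bordered-1ᴹ : ∀ {n} (j : Fin (suc n)) i b → bordered j 1ᴹ i (suc b) ≈ 1ᴹ i (punchIn j b)
  bordered-1ᴹ j i b = insertAt-cases (λ i x → x ≈ 1ᴹ i (punchIn j b)) (column 1ᴹ b) j 0#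
    (sym (1ᴹ-offdiag (punchInᵢ≢i j b ∘ ≡.sym)))
    (λ a → sym (1ᴹ-reindex (punchIn j) (punchIn-injective j _ _) a b)) i

  -- Moving the unit column from position suc j to position 0 is one swap of
  -- columns 0 and 1 followed by the same problem one size down.
  φ-bordered-1ᴹ : ∀ {n} (E : AlternatingForm (suc n)) j →
                  AlternatingForm.φ E (bordered j 1ᴹ) ≈ sign j * AlternatingForm.φ E 1ᴹ
  φ-bordered-1ᴹ E zero = trans (φ-cong (λ where
      i zero → refl
      i (suc b) → bordered-1ᴹ zero i b)) (sym (*-identityˡ _))
    where open AlternatingForm E
  φ-bordered-1ᴹ {suc n} E (suc j) = begin
    φ W                                 ≈⟨ sym (-‿involutive _) ⟩
    - (- φ W)                           ≈⟨ -‿cong (sym (swapColumns-negates φ φ-cong φ-additive zero (suc zero) (λ ())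
                                             (φ-alternating zero (suc zero) (λ ())) W)) ⟩
    - φ (swapColumns W zero (suc zero)) ≈⟨ -‿cong (φ-cong swapped) ⟩
    - φ (bordered zero (bordered j 1ᴹ)) ≈⟨ -‿cong (φ-bordered-1ᴹ (borderedForm E zero) j) ⟩
    - (sign j * φ (bordered zero 1ᴹ))   ≈⟨ -‿cong (*-congˡ (trans (φ-bordered-1ᴹ E zero) (*-identityˡ _))) ⟩
    - (sign j * φ 1ᴹ)                   ≈⟨ -‿distribˡ-* _ _ ⟩
    - sign j * φ 1ᴹ                     ∎
    where
    open AlternatingForm E
    W : Mat (suc (suc n))
    W = bordered (suc j) 1ᴹ
    shifted-unit : ∀ c (v : Fin (suc n) → Carrier) → (∀ a → v a ≈ 1ᴹ a c) →
                   ∀ i → 1ᴹ i (suc c) ≈ insertAt v zero 0# i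
    shifted-unit c v v≈ zero = 1ᴹ-offdiag {i = zero} {suc c} (λ ())
    shifted-unit c v v≈ (suc a) = trans (1ᴹ-reindex suc suc-injective a c) (sym (v≈ a))
    swapped : swapColumns W zero (suc zero) ≋ bordered zero (bordered j 1ᴹ)
    swapped i zero = trans (swapColumns-first W zero (suc zero) i) (bordered-1ᴹ (suc j) i zero)
    swapped i (suc zero) = trans (swapColumns-second W zero (suc zero) (λ ()) i)
                                 (shifted-unit j (column (bordered j 1ᴹ) zero) (λ _ → refl) i)
    swapped i (suc (suc b)) = trans (swapColumns-other W zero (suc zero) i (suc (suc b)) (λ ()) (λ ()))
                                    (trans (bordered-1ᴹ (suc j) i (suc b))
                                           (shifted-unit (punchIn j b) _ (λ a → bordered-1ᴹ j a b) i))

  -- Shearing the other columns by multiples of the unit column 0 clears row j.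
  φ-unitColumn₀ : ∀ {n} (E : AlternatingForm (suc n)) X j →
                  AlternatingForm.φ E (setColumn X zero (column 1ᴹ j)) ≈ AlternatingForm.φ E (bordered j (minorᵗ X j))
  φ-unitColumn₀ {n} E X j = trans (sym (φ-shear E W κ)) (φ-cong cleared)
    where
    open AlternatingForm E
    W : Mat (suc n)
    W = setColumn X zero (column 1ᴹ j)
    κ : Fin n → Carrier
    κ b = - X j (suc b)
    W₀ : ∀ i → W i zero ≈ 1ᴹ i j
    W₀ = setColumn-here X zero (column 1ᴹ j)
    Wₛ : ∀ i b → W i (suc b) ≈ X i (suc b)
    Wₛ i b = setColumn-other X zero (column 1ᴹ j) i (λ ())
    cleared : shear W κ ≋ bordered j (minorᵗ X j)
    cleared i zero = W₀ i
    cleared i (suc b) = insertAt-cases (λ i x → W i (suc b) + κ b * W i zero ≈ x) (column (minorᵗ X j) b) j 0#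
      (begin
        W j (suc b) + κ b * W j zero   ≈⟨ +-cong (Wₛ j b) (*-congˡ (trans (W₀ j) (1ᴹ-diag j))) ⟩
        X j (suc b) + κ b * 1#         ≈⟨ +-congˡ (*-identityʳ _) ⟩
        X j (suc b) - X j (suc b)      ≈⟨ -‿inverseʳ _ ⟩
        0#                             ∎)
      (λ a → begin
        W (punchIn j a) (suc b) + κ b * W (punchIn j a) zero
          ≈⟨ +-cong (Wₛ _ b) (*-congˡ (trans (W₀ (punchIn j a)) (1ᴹ-offdiag (punchInᵢ≢i j a)))) ⟩
        X (punchIn j a) (suc b) + κ b * 0#                    ≈⟨ +-congˡ (zeroʳ _) ⟩
        X (punchIn j a) (suc b) + 0#                          ≈⟨ +-identityʳ _ ⟩
        X (punchIn j a) (suc b)                               ∎)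
      i

  -- Expand column 0 in the unit vectors; each term is a form in one dimension less.
  alternatingForm-unique : ∀ {n} (E : AlternatingForm n) X →
                           AlternatingForm.φ E X ≈ det X * AlternatingForm.φ E 1ᴹ
  alternatingForm-unique {zero} E X = trans (AlternatingForm.φ-cong E (λ ())) (sym (*-identityˡ _))
  alternatingForm-unique {suc n} E X = begin
    φ X                                                        ≈⟨ φ-cong X≋ ⟩
    φ (setColumn X zero expanded)                              ≈⟨ φ-linear X zero (λ j → X j zero) (column 1ᴹ) ⟩
    sum (λ j → X j zero * φ (setColumn X zero (column 1ᴹ j)))  ≈⟨ sum-cong {f = λ j → X j zero * φ (setColumn X zero (column 1ᴹ j))} term ⟩
    sum (λ j → col₀-term X j * φ 1ᴹ)                           ≈⟨ sym (*-distribʳ-sum (φ 1ᴹ) (col₀-term X)) ⟩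
    sum (col₀-term X) * φ 1ᴹ                                   ≈⟨ *-congʳ (sym (det-expand-col₀ X)) ⟩
    det X * φ 1ᴹ                                               ∎
    where
    open AlternatingForm E
    open AlternatingFormProperties E
    expanded : Fin (suc n) → Carrier
    expanded i = sum (λ j → X j zero * 1ᴹ i j)
    X≋ : X ≋ setColumn X zero expanded
    X≋ i zero = sym (trans (setColumn-here X zero expanded i)
                           (trans (sum-cong {f = λ j → X j zero * 1ᴹ i j} (λ j → *-congˡ (1ᴹ-sym i j)))
                                  (sum-*-1ᴹ (λ j → X j zero) i)))
    X≋ i (suc b) = sym (setColumn-other X zero expanded i (λ ()))
    term : ∀ j → X j zero * φ (setColumn X zero (column 1ᴹ j)) ≈ col₀-term X j * φ 1ᴹ
    term j = begin
      X j zero * φ (setColumn X zero (column 1ᴹ j))      ≈⟨ *-congˡ (φ-unitColumn₀ E X j) ⟩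
      X j zero * φ (bordered j (minorᵗ X j))              ≈⟨ *-congˡ (alternatingForm-unique (borderedForm E j) (minorᵗ X j)) ⟩
      X j zero * (det (minorᵗ X j) * φ (bordered j 1ᴹ))   ≈⟨ *-congˡ (*-congˡ (φ-bordered-1ᴹ E j)) ⟩
      X j zero * (det (minorᵗ X j) * (sign j * φ 1ᴹ))
        ≈⟨ solve 4 (λ x d s f → x :* (d :* (s :* f)) := (s :* (x :* d)) :* f) refl _ _ _ _ ⟩
      col₀-term X j * φ 1ᴹ                                ∎

  ⊛-agreeOff : ∀ {n} (A : Mat n) {X Z k} → AgreeOff k X Z → AgreeOff k (A ⊛ X) (A ⊛ Z)
  ⊛-agreeOff A {X} {Z} X~Z i j j≢k = sum-cong {f = λ l → A i l * X l j} {g = λ l → A i l * Z l j}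
                                       (λ l → *-congˡ (X~Z l j j≢k))

  productForm : ∀ {n} (A : Mat n) → AlternatingForm n
  productForm A = record
    { φ = λ B → det (A ⊛ B)
    ; φ-cong = λ {X} {Y} X≋Y → det-cong λ i k →
        sum-cong {f = λ l → A i l * X l k} {g = λ l → A i l * Y l k} (λ l → *-congˡ (X≋Y l k))
    ; φ-additive = λ X Y Z k X~Z Y~Z Zk → det-additive (A ⊛ X) (A ⊛ Y) (A ⊛ Z) k
        (⊛-agreeOff A X~Z) (⊛-agreeOff A Y~Z)
        (λ i → trans (sum-cong {f = λ l → A i l * Z l k} {g = λ l → A i l * X l k + A i l * Y l k}
                                (λ l → trans (*-congˡ (Zk l)) (distribˡ _ _ _)))
                     (∑-distrib-+ (λ l → A i l * X l k) (λ l → A i l * Y l k)))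
    ; φ-homogeneous = λ X Z k s X~Z Zk → det-homogeneous (A ⊛ X) (A ⊛ Z) k s (⊛-agreeOff A X~Z)
        (λ i → trans (sum-cong {f = λ l → A i l * Z l k} {g = λ l → s * (A i l * X l k)}
                                (λ l → trans (*-congˡ (Zk l)) (x∙yz≈y∙xz _ _ _)))
                     (sym (*-distribˡ-sum s (λ l → A i l * X l k))))
    ; φ-alternating = λ a b a≢b X Xab → det-alternating a b a≢b (A ⊛ X) λ i →
        sum-cong {f = λ l → A i l * X l a} {g = λ l → A i l * X l b} (λ l → *-congˡ (Xab l))
    }

  ⊛-identityʳ : ∀ {n} (A : Mat n) → A ⊛ 1ᴹ ≋ A
  ⊛-identityʳ A i k = sum-*-1ᴹ (A i) k

  det-1ᴹ : ∀ {n} → det (1ᴹ {n}) ≈ 1#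
  det-1ᴹ {zero} = refl
  det-1ᴹ {suc n} = begin
    sum (row₀-term I)                       ≈⟨ sum-concentrated (row₀-term I) zero off-diagonal ⟩
    1# * (I zero zero * det (minor I zero)) ≈⟨ *-identityˡ _ ⟩
    I zero zero * det (minor I zero)        ≈⟨ *-cong (1ᴹ-diag {suc n} zero) (trans (det-cong minor≋1ᴹ) (det-1ᴹ {n})) ⟩
    1# * 1#                                 ≈⟨ *-identityˡ _ ⟩
    1#                                      ∎
    where
    I : Mat (suc n)
    I = 1ᴹ
    minor≋1ᴹ : minor I zero ≋ 1ᴹ
    minor≋1ᴹ = 1ᴹ-reindex suc suc-injective
    off-diagonal : ∀ j → j ≢ zero → row₀-term I j ≈ 0#
    off-diagonal j j≢0 = trans (*-congˡ (trans (*-congʳ (1ᴹ-offdiag (j≢0 ∘ ≡.sym))) (zeroˡ _))) (zeroʳ _)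

  det-⊛ : ∀ {n} (A B : Mat n) → det (A ⊛ B) ≈ det A * det B
  det-⊛ A B = trans (alternatingForm-unique (productForm A) B)
                    (trans (*-congˡ (det-cong (⊛-identityʳ A))) (*-comm _ _))

  det-setColumn-combination : ∀ {n} (Q : Mat n) (w : Fin n → Carrier) j →
                              det (setColumn Q j (λ p → sum (λ d → w d * Q p d))) ≈ w j * det Q
  det-setColumn-combination Q w j = begin
    det (setColumn Q j (λ p → sum (λ d → w d * Q p d)))  ≈⟨ φ-linear Q j w (column Q) ⟩
    sum (λ d → w d * det (setColumn Q j (column Q d)))   ≈⟨ sum-concentrated _ j other-column ⟩
    w j * det (setColumn Q j (column Q j))               ≈⟨ *-congˡ (det-cong (setColumn-id Q j (column Q j) (λ _ → refl))) ⟩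
    w j * det Q                                          ∎
    where
    open AlternatingFormProperties (detForm _)
    other-column : ∀ d → d ≢ j → w d * det (setColumn Q j (column Q d)) ≈ 0#
    other-column d d≢j = trans (*-congˡ (det-alternating j d (d≢j ∘ ≡.sym) _ λ i →
      trans (setColumn-here Q j (column Q d) i) (sym (setColumn-other Q j (column Q d) i d≢j)))) (zeroʳ _)

  rightInverse⇒injective : ∀ {n} (Q R : Mat n) (w : Fin n → Carrier) → Q ⊛ R ≋ 1ᴹ →
                           (∀ p → sum (λ d → Q p d * w d) ≈ 0#) → ∀ j → w j ≈ 0#
  rightInverse⇒injective {n} Q R w QR≋1 Qw≈0 j = begin
    w j                                       ≈⟨ sym (*-identityʳ _) ⟩
    w j * 1#                                  ≈⟨ *-congˡ (sym (trans (sym (det-⊛ Q R)) (trans (det-cong QR≋1) (det-1ᴹ {n})))) ⟩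
    w j * (det Q * det R)                     ≈⟨ sym (*-assoc _ _ _) ⟩
    (w j * det Q) * det R                     ≈⟨ *-congʳ (sym (det-setColumn-combination Q w j)) ⟩
    det (setColumn Q j Qw) * det R            ≈⟨ *-congʳ (φ-zeroColumn _ j Qw-column≈0) ⟩
    0# * det R                                ≈⟨ zeroˡ _ ⟩
    0#                                        ∎
    where
    open AlternatingFormProperties (detForm _)
    Qw : Fin n → Carrier
    Qw p = sum (λ d → w d * Q p d)
    Qw-column≈0 : ∀ p → setColumn Q j Qw p j ≈ 0#
    Qw-column≈0 p = trans (setColumn-here Q j Qw p)
                          (trans (sum-cong {f = λ d → w d * Q p d} (λ d → *-comm _ _)) (Qw≈0 p))

module BlockStructure {c ℓ} (F : Field c ℓ) (n m r t : ℕ) where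
  open Field F hiding (zero)
  open Determinant commutativeRing
  open import Algebra.Properties.Semiring.Sum semiring using (sum)
  open import Algebra.Properties.Ring ring using (-1*x≈-x; -‿involutive; -0#≈0#)
  open import Algebra.Solver.Ring.NaturalCoefficients.Default commutativeSemiring
  open import Relation.Binary.Reasoning.Setoid setoid

  N K : ℕ
  N = blockSize n m r t
  K = n ℕ.+ r

  e₁ e₃ : Fin n → Fin N
  e₂ : Fin m → Fin N
  e₄ e₅ : Fin r → Fin N
  e₆ : Fin t → Fin N
  e₁ = emb₁ {n} {m} {r} {t}
  e₂ = emb₂ {n} {m} {r} {t}
  e₃ = emb₃ {n} {m} {r} {t}
  e₄ = emb₄ {n} {m} {r} {t}
  e₅ = emb₅ {n} {m} {r} {t}
  e₆ = emb₆ {n} {m} {r} {t}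

  M : Matrix F N N
  M = Mform F n m r t

  private
    S₁ S₂ S₃ S₄ : ℕ
    S₄ = r ℕ.+ t
    S₃ = r ℕ.+ S₄
    S₂ = n ℕ.+ S₃
    S₁ = m ℕ.+ S₂

  whichBlock-e₁ : ∀ a → whichBlock {n} {m} {r} {t} (e₁ a) ≡ inj₁ a
  whichBlock-e₁ a rewrite splitAt-↑ˡ n a S₁ = ≡.refl

  whichBlock-e₂ : ∀ a → whichBlock {n} {m} {r} {t} (e₂ a) ≡ inj₂ (inj₁ a)
  whichBlock-e₂ a rewrite splitAt-↑ʳ n S₁ (a ↑ˡ S₂) | splitAt-↑ˡ m a S₂ = ≡.refl

  whichBlock-e₃ : ∀ a → whichBlock {n} {m} {r} {t} (e₃ a) ≡ inj₂ (inj₂ (inj₁ a))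
  whichBlock-e₃ a rewrite splitAt-↑ʳ n S₁ (m ↑ʳ (a ↑ˡ S₃)) | splitAt-↑ʳ m S₂ (a ↑ˡ S₃)
                        | splitAt-↑ˡ n a S₃ = ≡.refl

  whichBlock-e₄ : ∀ a → whichBlock {n} {m} {r} {t} (e₄ a) ≡ inj₂ (inj₂ (inj₂ (inj₁ a)))
  whichBlock-e₄ a rewrite splitAt-↑ʳ n S₁ (m ↑ʳ (n ↑ʳ (a ↑ˡ S₄))) | splitAt-↑ʳ m S₂ (n ↑ʳ (a ↑ˡ S₄))
                        | splitAt-↑ʳ n S₃ (a ↑ˡ S₄) | splitAt-↑ˡ r a S₄ = ≡.refl

  whichBlock-e₅ : ∀ a → whichBlock {n} {m} {r} {t} (e₅ a) ≡ inj₂ (inj₂ (inj₂ (inj₂ (inj₁ a))))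
  whichBlock-e₅ a rewrite splitAt-↑ʳ n S₁ (m ↑ʳ (n ↑ʳ (r ↑ʳ (a ↑ˡ t))))
                        | splitAt-↑ʳ m S₂ (n ↑ʳ (r ↑ʳ (a ↑ˡ t))) | splitAt-↑ʳ n S₃ (r ↑ʳ (a ↑ˡ t))
                        | splitAt-↑ʳ r S₄ (a ↑ˡ t) | splitAt-↑ˡ r a t = ≡.refl

  whichBlock-e₆ : ∀ a → whichBlock {n} {m} {r} {t} (e₆ a) ≡ inj₂ (inj₂ (inj₂ (inj₂ (inj₂ a))))
  whichBlock-e₆ a rewrite splitAt-↑ʳ n S₁ (m ↑ʳ (n ↑ʳ (r ↑ʳ (r ↑ʳ a))))
                        | splitAt-↑ʳ m S₂ (n ↑ʳ (r ↑ʳ (r ↑ʳ a))) | splitAt-↑ʳ n S₃ (r ↑ʳ (r ↑ʳ a))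
                        | splitAt-↑ʳ r S₄ (r ↑ʳ a) | splitAt-↑ʳ r t a = ≡.refl

  M-row₂ : ∀ a l → M (e₂ a) l ≡ 0#
  M-row₂ a l rewrite whichBlock-e₂ a = ≡.refl

  M-row₆ : ∀ a l → M (e₆ a) l ≡ 0#
  M-row₆ a l rewrite whichBlock-e₆ a = ≡.refl

  M-column₂ : ∀ l a → M l (e₂ a) ≡ 0#
  M-column₂ l a rewrite whichBlock-e₂ a with whichBlock {n} {m} {r} {t} l
  ... | inj₁ _ = ≡.refl
  ... | inj₂ (inj₁ _) = ≡.refl
  ... | inj₂ (inj₂ (inj₁ _)) = ≡.refl
  ... | inj₂ (inj₂ (inj₂ (inj₁ _))) = ≡.refl
  ... | inj₂ (inj₂ (inj₂ (inj₂ (inj₁ _)))) = ≡.refl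
  ... | inj₂ (inj₂ (inj₂ (inj₂ (inj₂ _)))) = ≡.refl

  M-column₆ : ∀ l a → M l (e₆ a) ≡ 0#
  M-column₆ l a rewrite whichBlock-e₆ a with whichBlock {n} {m} {r} {t} l
  ... | inj₁ _ = ≡.refl
  ... | inj₂ (inj₁ _) = ≡.refl
  ... | inj₂ (inj₂ (inj₁ _)) = ≡.refl
  ... | inj₂ (inj₂ (inj₂ (inj₁ _))) = ≡.refl
  ... | inj₂ (inj₂ (inj₂ (inj₂ (inj₁ _)))) = ≡.refl
  ... | inj₂ (inj₂ (inj₂ (inj₂ (inj₂ _)))) = ≡.refl

  δ≈1ᴹ : ∀ {k} (a b : Fin k) → δ F a b ≈ 1ᴹ a b
  δ≈1ᴹ a b with a ≟ b
  ... | yes _ = refl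
  ... | no _ = refl

  ιL ιR : Fin n ⊎ Fin r → Fin N
  ιL = [ e₁ , e₄ ]′
  ιR = [ e₃ , e₅ ]′

  M-ιLιR : ∀ u v → M (ιL u) (ιR v) ≈ δ⊎ u v
  M-ιLιR (inj₁ a) (inj₁ b) rewrite whichBlock-e₁ a | whichBlock-e₃ b = δ≈1ᴹ a b
  M-ιLιR (inj₁ a) (inj₂ b) rewrite whichBlock-e₁ a | whichBlock-e₅ b = refl
  M-ιLιR (inj₂ a) (inj₁ b) rewrite whichBlock-e₄ a | whichBlock-e₃ b = refl
  M-ιLιR (inj₂ a) (inj₂ b) rewrite whichBlock-e₄ a | whichBlock-e₅ b = δ≈1ᴹ a b

  M-ιRιL : ∀ u v → M (ιR u) (ιL v) ≈ - δ⊎ u v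
  M-ιRιL (inj₁ a) (inj₁ b) rewrite whichBlock-e₃ a | whichBlock-e₁ b = -‿cong (δ≈1ᴹ a b)
  M-ιRιL (inj₁ a) (inj₂ b) rewrite whichBlock-e₃ a | whichBlock-e₄ b = sym -0#≈0#
  M-ιRιL (inj₂ a) (inj₁ b) rewrite whichBlock-e₅ a | whichBlock-e₁ b = sym -0#≈0#
  M-ιRιL (inj₂ a) (inj₂ b) rewrite whichBlock-e₅ a | whichBlock-e₄ b = -‿cong (δ≈1ᴹ a b)

  M-ιLιL : ∀ u v → M (ιL u) (ιL v) ≈ 0#
  M-ιLιL (inj₁ a) (inj₁ b) rewrite whichBlock-e₁ a | whichBlock-e₁ b = refl
  M-ιLιL (inj₁ a) (inj₂ b) rewrite whichBlock-e₁ a | whichBlock-e₄ b = refl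
  M-ιLιL (inj₂ a) (inj₁ b) rewrite whichBlock-e₄ a | whichBlock-e₁ b = refl
  M-ιLιL (inj₂ a) (inj₂ b) rewrite whichBlock-e₄ a | whichBlock-e₄ b = refl

  M-ιRιR : ∀ u v → M (ιR u) (ιR v) ≈ 0#
  M-ιRιR (inj₁ a) (inj₁ b) rewrite whichBlock-e₃ a | whichBlock-e₃ b = refl
  M-ιRιR (inj₁ a) (inj₂ b) rewrite whichBlock-e₃ a | whichBlock-e₅ b = refl
  M-ιRιR (inj₂ a) (inj₁ b) rewrite whichBlock-e₅ a | whichBlock-e₃ b = refl
  M-ιRιR (inj₂ a) (inj₂ b) rewrite whichBlock-e₅ a | whichBlock-e₅ b = refl

  ι⊎ : Fin K ⊎ Fin K → Fin N
  ι⊎ = [ ιL ∘ splitAt n , ιR ∘ splitAt n ]′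

  ι : Fin (K ℕ.+ K) → Fin N
  ι = ι⊎ ∘ splitAt K

  π : Fin (K ℕ.+ K) → Fin (K ℕ.+ K)
  π = join K K ∘ Sum.swap ∘ splitAt K

  sgn⊎ : Fin K ⊎ Fin K → Carrier
  sgn⊎ = [ const (- 1#) , const 1# ]′

  sgn : Fin (K ℕ.+ K) → Carrier
  sgn = sgn⊎ ∘ splitAt K

  π-involutive : ∀ d → π (π d) ≡ d
  π-involutive d = ≡.trans (≡.cong (join K K ∘ Sum.swap) (splitAt-join K K (Sum.swap (splitAt K d))))
                           (≡.trans (≡.cong (join K K) (swap-involutive (splitAt K d))) (join-splitAt K K d))

  sgn-square : ∀ d → sgn d * sgn d ≈ 1#
  sgn-square d with splitAt K d
  ... | inj₁ _ = trans (-1*x≈-x _) (-‿involutive 1#)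
  ... | inj₂ _ = *-identityˡ 1#

  -- M restricted to the blocks 1, 4, 3, 5 (in this order) is the standard symplectic
  -- form, a signed permutation matrix.
  M-ι : ∀ d c → M (ι d) (ι c) ≈ sgn c * 1ᴹ d (π c)
  M-ι d c = trans (halves (splitAt K d) (splitAt K c))
                  (*-congˡ (sym (trans (1ᴹ-splitAt K d (π c))
                                       (reflexive (≡.cong (δ⊎ (splitAt K d)) (splitAt-join K K (Sum.swap (splitAt K c))))))))
    where
    halves : ∀ U V → M (ι⊎ U) (ι⊎ V) ≈ sgn⊎ V * δ⊎ U (Sum.swap V)
    halves (inj₁ x) (inj₁ y) = trans (M-ιLιL (splitAt n x) (splitAt n y)) (sym (zeroʳ _))
    halves (inj₁ x) (inj₂ y) = trans (M-ιLιR (splitAt n x) (splitAt n y))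
                                     (trans (sym (1ᴹ-splitAt n x y)) (sym (*-identityˡ _)))
    halves (inj₂ x) (inj₁ y) = trans (M-ιRιL (splitAt n x) (splitAt n y))
                                     (trans (-‿cong (sym (1ᴹ-splitAt n x y))) (sym (-1*x≈-x _)))
    halves (inj₂ x) (inj₂ y) = trans (M-ιRιR (splitAt n x) (splitAt n y)) (sym (zeroʳ _))

  sgn-1ᴹ-π : ∀ p q → sgn p * (sgn q * 1ᴹ (π p) (π q)) ≈ 1ᴹ q p
  sgn-1ᴹ-π p q with p ≟ q
  ... | yes ≡.refl = begin
    sgn p * (sgn p * 1ᴹ (π p) (π p)) ≈⟨ *-congˡ (*-congˡ (1ᴹ-diag (π p))) ⟩
    sgn p * (sgn p * 1#)             ≈⟨ trans (*-congˡ (*-identityʳ _)) (sgn-square p) ⟩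
    1#                               ≈⟨ sym (1ᴹ-diag p) ⟩
    1ᴹ p p                           ∎
  ... | no p≢q = trans (*-congˡ (trans (*-congˡ (1ᴹ-offdiag (p≢q ∘ π-injective))) (zeroʳ _)))
                       (trans (zeroʳ _) (sym (1ᴹ-offdiag (p≢q ∘ ≡.sym))))
    where
    π-injective : ∀ {p q} → π p ≡ π q → p ≡ q
    π-injective {p} {q} eq = ≡.trans (≡.sym (π-involutive p)) (≡.trans (≡.cong π eq) (π-involutive q))

  ι-e₁ : ∀ b → ι ((b ↑ˡ r) ↑ˡ K) ≡ e₁ b
  ι-e₁ b rewrite splitAt-↑ˡ K (b ↑ˡ r) K | splitAt-↑ˡ n b r = ≡.refl

  ι-e₄ : ∀ b → ι ((n ↑ʳ b) ↑ˡ K) ≡ e₄ b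
  ι-e₄ b rewrite splitAt-↑ˡ K (n ↑ʳ b) K | splitAt-↑ʳ n r b = ≡.refl

  ι-e₃ : ∀ b → ι (K ↑ʳ (b ↑ˡ r)) ≡ e₃ b
  ι-e₃ b rewrite splitAt-↑ʳ K K (b ↑ˡ r) | splitAt-↑ˡ n b r = ≡.refl

  ι-e₅ : ∀ b → ι (K ↑ʳ (n ↑ʳ b)) ≡ e₅ b
  ι-e₅ b rewrite splitAt-↑ʳ K K (n ↑ʳ b) | splitAt-↑ʳ n r b = ≡.refl

  sum-+ : ∀ {a b} (f : Fin (a ℕ.+ b) → Carrier) → sum f ≈ sum (f ∘ (_↑ˡ b)) + sum (f ∘ (a ↑ʳ_))
  sum-+ {zero} f = sym (+-identityˡ _)
  sum-+ {suc a} f = trans (+-congˡ (sum-+ {a} (f ∘ Fin.suc))) (sym (+-assoc _ _ _))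

  sum-blocks : ∀ f → sum f ≈ sum (f ∘ e₁) + (sum (f ∘ e₂) + (sum (f ∘ e₃) +
                           (sum (f ∘ e₄) + (sum (f ∘ e₅) + sum (f ∘ e₆)))))
  sum-blocks f = trans (sum-+ {n} f) (+-congˡ (trans (sum-+ {m} (f ∘ (n ↑ʳ_)))
                   (+-congˡ (trans (sum-+ {n} (f ∘ (n ↑ʳ_) ∘ (m ↑ʳ_)))
                   (+-congˡ (trans (sum-+ {r} (f ∘ (n ↑ʳ_) ∘ (m ↑ʳ_) ∘ (n ↑ʳ_)))
                   (+-congˡ (sum-+ {r} (f ∘ (n ↑ʳ_) ∘ (m ↑ʳ_) ∘ (n ↑ʳ_) ∘ (r ↑ʳ_))))))))))

  sum-ι : ∀ f → sum (f ∘ ι) ≈ (sum (f ∘ e₁) + sum (f ∘ e₄)) + (sum (f ∘ e₃) + sum (f ∘ e₅))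
  sum-ι f = trans (sum-+ {K} (f ∘ ι)) (+-cong
    (trans (sum-+ {n} (f ∘ ι ∘ (_↑ˡ K))) (+-cong (sum-along ι-e₁) (sum-along ι-e₄)))
    (trans (sum-+ {n} (f ∘ ι ∘ (K ↑ʳ_))) (+-cong (sum-along ι-e₃) (sum-along ι-e₅))))
    where
    sum-along : ∀ {k} {g : Fin k → Fin (K ℕ.+ K)} {e : Fin k → Fin N} → (∀ b → ι (g b) ≡ e b) →
                sum (f ∘ ι ∘ g) ≈ sum (f ∘ e)
    sum-along ι-g = sum-cong (reflexive ∘ ≡.cong f ∘ ι-g)

  sum-restrict : ∀ f → (∀ a → f (e₂ a) ≈ 0#) → (∀ a → f (e₆ a) ≈ 0#) → sum f ≈ sum (f ∘ ι)
  sum-restrict f f₂≈0 f₆≈0 = begin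
    sum f
      ≈⟨ sum-blocks f ⟩
    s₁ + (sum (f ∘ e₂) + (s₃ + (s₄ + (s₅ + sum (f ∘ e₆)))))
      ≈⟨ +-congˡ (+-cong (sum-≈0 _ f₂≈0) (+-congˡ (+-congˡ (+-congˡ (sum-≈0 _ f₆≈0))))) ⟩
    s₁ + (0# + (s₃ + (s₄ + (s₅ + 0#))))
      ≈⟨ solve 4 (λ s₁ s₃ s₄ s₅ → s₁ :+ (con 0 :+ (s₃ :+ (s₄ :+ (s₅ :+ con 0))))
                                  := (s₁ :+ s₄) :+ (s₃ :+ s₅)) refl s₁ s₃ s₄ s₅ ⟩
    (s₁ + s₄) + (s₃ + s₅)
      ≈⟨ sym (sum-ι f) ⟩
    sum (f ∘ ι) ∎
    where
    s₁ s₃ s₄ s₅ : Carrier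
    s₁ = sum (f ∘ e₁)
    s₃ = sum (f ∘ e₃)
    s₄ = sum (f ∘ e₄)
    s₅ = sum (f ∘ e₅)

  VanishesOnBlocks1345 : (Fin N → Carrier) → Set ℓ
  VanishesOnBlocks1345 f = (∀ b → f (e₁ b) ≈ 0#) × (∀ b → f (e₃ b) ≈ 0#) ×
                           (∀ b → f (e₄ b) ≈ 0#) × (∀ b → f (e₅ b) ≈ 0#)

  ι-vanishing⇒blocks : ∀ (f : Fin N → Carrier) → (∀ d → f (ι d) ≈ 0#) → VanishesOnBlocks1345 f
  ι-vanishing⇒blocks f f≈0 = at ι-e₁ , at ι-e₃ , at ι-e₄ , at ι-e₅
    where
    at : ∀ {k} {e : Fin k → Fin N} {g : Fin k → Fin (K ℕ.+ K)} → (∀ b → ι (g b) ≡ e b) → ∀ b → f (e b) ≈ 0#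
    at ι-g b = ≡.subst (λ l → f l ≈ 0#) (ι-g b) (f≈0 _)

  cancel-unit : ∀ {u v x} → v * u ≈ 1# → u * x ≈ 0# → x ≈ 0#
  cancel-unit {u} {v} {x} vu≈1 ux≈0 = begin
    x             ≈⟨ sym (*-identityˡ x) ⟩
    1# * x        ≈⟨ *-congʳ (sym vu≈1) ⟩
    (v * u) * x   ≈⟨ *-assoc v u x ⟩
    v * (u * x)   ≈⟨ *-congˡ ux≈0 ⟩
    v * 0#        ≈⟨ zeroʳ v ⟩
    0#            ∎

  module _ (P : Matrix F N N) where
    twisted : Fin N → Fin (K ℕ.+ K) → Carrier
    twisted i c = sgn c * P i (ι (π c))

    PM-ι : ∀ i c → _⊗_ F P M i (ι c) ≈ twisted i c
    PM-ι i c = begin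
      sum (λ l → P i l * M l (ι c))
        ≈⟨ sum-restrict (λ l → P i l * M l (ι c)) (vanishes ∘ M-row₂) (vanishes ∘ M-row₆) ⟩
      sum (λ d → P i (ι d) * M (ι d) (ι c))
        ≈⟨ sum-cong (λ d → *-congˡ (M-ι d c)) ⟩
      sum (λ d → P i (ι d) * (sgn c * 1ᴹ d (π c)))
        ≈⟨ sum-factor (sgn c) (λ d → P i (ι d)) (λ d → 1ᴹ d (π c)) ⟩
      sgn c * sum (λ d → P i (ι d) * 1ᴹ d (π c))
        ≈⟨ *-congˡ (sum-*-1ᴹ (λ d → P i (ι d)) (π c)) ⟩
      sgn c * P i (ι (π c)) ∎
      where
      vanishes : ∀ {l} → (∀ j → M l j ≡ 0#) → P i l * M l (ι c) ≈ 0#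
      vanishes M-row = trans (*-congˡ (reflexive (M-row (ι c)))) (zeroʳ _)

    PM-column≈0 : ∀ i {l} → (∀ k → M k l ≡ 0#) → _⊗_ F P M i l ≈ 0#
    PM-column≈0 i M-column = sum-≈0 _ (λ k → trans (*-congˡ (reflexive (M-column k))) (zeroʳ _))

    PMPᵗ-ι : ∀ i j → _⊗_ F (_⊗_ F P M) (transpose F P) i j ≈ sum (λ c → P j (ι c) * twisted i c)
    PMPᵗ-ι i j = trans (sum-restrict (λ l → _⊗_ F P M i l * P j l)
                         (λ a → trans (*-congʳ (PM-column≈0 i (λ k → M-column₂ k a))) (zeroˡ _))
                         (λ a → trans (*-congʳ (PM-column≈0 i (λ k → M-column₆ k a))) (zeroˡ _)))
                       (sum-cong (λ c → trans (*-congʳ (PM-ι i c)) (*-comm _ _)))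

    module _ (σ : Carrier) (H : _≈ᴹ_ F (scale F σ (_⊗_ F (_⊗_ F P M) (transpose F P))) M) where
      Q : Mat (K ℕ.+ K)
      Q p c = P (ι p) (ι c)

      Q-twisted : ∀ i q → sum (λ c → Q q c * (σ * twisted i c)) ≈ M i (ι q)
      Q-twisted i q = begin
        sum (λ c → Q q c * (σ * twisted i c))          ≈⟨ sum-factor σ (Q q) (twisted i) ⟩
        σ * sum (λ c → Q q c * twisted i c)            ≈⟨ *-congˡ (sym (PMPᵗ-ι i (ι q))) ⟩
        σ * _⊗_ F (_⊗_ F P M) (transpose F P) i (ι q)  ≈⟨ H i (ι q) ⟩
        M i (ι q)                                      ∎

      -- R = σ J Qᵀ Jᵀ, written out entrywise using that J is a signed permutation matrix.
      R : Mat (K ℕ.+ K)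
      R c p = sgn p * (σ * twisted (ι (π p)) c)

      Q⊛R : Q ⊛ R ≋ 1ᴹ
      Q⊛R q p = begin
        sum (λ c → Q q c * (sgn p * (σ * twisted (ι (π p)) c)))  ≈⟨ sum-factor (sgn p) (Q q) (λ c → σ * twisted (ι (π p)) c) ⟩
        sgn p * sum (λ c → Q q c * (σ * twisted (ι (π p)) c))    ≈⟨ *-congˡ (Q-twisted (ι (π p)) q) ⟩
        sgn p * M (ι (π p)) (ι q)                                ≈⟨ *-congˡ (M-ι (π p) q) ⟩
        sgn p * (sgn q * 1ᴹ (π p) (π q))                         ≈⟨ sgn-1ᴹ-π p q ⟩
        1ᴹ q p                                                   ∎

      null-row-vanishes-on-blocks : ¬ (σ ≈ 0#) → ∀ i → (∀ l → M i l ≡ 0#) → VanishesOnBlocks1345 (P i)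
      null-row-vanishes-on-blocks σ≉0 i M-row = ι-vanishing⇒blocks (P i) λ d →
        ≡.subst (λ d → P i (ι d) ≈ 0#) (π-involutive d) (cancel-unit (sgn-square (π d)) (cancel-unit σ⁻¹σ≈1
          (rightInverse⇒injective Q R (λ c → σ * twisted i c) Q⊛R
            (λ q → trans (Q-twisted i q) (reflexive (M-row (ι q)))) (π d))))
        where
        σ⁻¹σ≈1 : proj₁ (inverse σ σ≉0) * σ ≈ 1#
        σ⁻¹σ≈1 = trans (*-comm _ _) (proj₂ (inverse σ σ≉0))

lemma2p2 : ∀ {c ℓ : Level} (F : Field c ℓ) (n m r t : ℕ)
           (P : Matrix F (blockSize n m r t) (blockSize n m r t))
           (σ : Field.Carrier F) →
           ¬ (Field._≈_ F σ (Field.0# F)) →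
           _≈ᴹ_ F (scale F σ (_⊗_ F (_⊗_ F P (Mform F n m r t)) (transpose F P))) (Mform F n m r t) →
           (∀ a b → Field._≈_ F (P (emb₂ {n} {m} {r} {t} a) (emb₁ {n} {m} {r} {t} b)) (Field.0# F))
           × (∀ a b → Field._≈_ F (P (emb₂ {n} {m} {r} {t} a) (emb₃ {n} {m} {r} {t} b)) (Field.0# F))
           × (∀ a b → Field._≈_ F (P (emb₂ {n} {m} {r} {t} a) (emb₄ {n} {m} {r} {t} b)) (Field.0# F))
           × (∀ a b → Field._≈_ F (P (emb₂ {n} {m} {r} {t} a) (emb₅ {n} {m} {r} {t} b)) (Field.0# F))
           × (∀ a b → Field._≈_ F (P (emb₆ {n} {m} {r} {t} a) (emb₁ {n} {m} {r} {t} b)) (Field.0# F))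
           × (∀ a b → Field._≈_ F (P (emb₆ {n} {m} {r} {t} a) (emb₃ {n} {m} {r} {t} b)) (Field.0# F))
           × (∀ a b → Field._≈_ F (P (emb₆ {n} {m} {r} {t} a) (emb₄ {n} {m} {r} {t} b)) (Field.0# F))
           × (∀ a b → Field._≈_ F (P (emb₆ {n} {m} {r} {t} a) (emb₅ {n} {m} {r} {t} b)) (Field.0# F))
lemma2p2 F n m r t P σ σ≉0 H =
    (λ a → proj₁ (row₂ a)) , (λ a → proj₁ (proj₂ (row₂ a)))
  , (λ a → proj₁ (proj₂ (proj₂ (row₂ a)))) , (λ a → proj₂ (proj₂ (proj₂ (row₂ a))))
  , (λ a → proj₁ (row₆ a)) , (λ a → proj₁ (proj₂ (row₆ a)))
  , (λ a → proj₁ (proj₂ (proj₂ (row₆ a)))) , (λ a → proj₂ (proj₂ (proj₂ (row₆ a))))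
  where
  open BlockStructure F n m r t
  row₂ : ∀ a → VanishesOnBlocks1345 (P (e₂ a))
  row₂ a = null-row-vanishes-on-blocks P σ H σ≉0 (e₂ a) (M-row₂ a)
  row₆ : ∀ a → VanishesOnBlocks1345 (P (e₆ a))
  row₆ a = null-row-vanishes-on-blocks P σ H σ≉0 (e₆ a) (M-row₆ a)
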